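{- Let $P$ be a finite poset containing two elements $p<q$, let $r\geq 1$, and let $\imath:[r]\to[2r]$ be strictly increasing with $\imath(1)=1$. Then the relation $\preceq_\imath$ is a partial order on $P_r$ if and only if for every $2\leq t\leq r$ we have $\imath(t)=2t$ if $t$ is even and $\imath(t)=2t-1$ if $t$ is odd.
   Context: For a natural number $n$, $[n]=\{1,\dots,n\}$. For a finite poset $(P,\leq)$ and $r\geq 1$, $P_r$ denotes the set of all $r$-multichains $\mathfrak{p}: p_1\leq \cdots\leq p_r$ of elements of $P$. For a strictly increasing map $\imath:[r]\to[2r]$ define the relation $\preceq_\imath$ on $P_r$: for $\mathfrak{p}: p_1\leq\cdots\leq p_r$ and $\mathfrak{q}: q_1\leq\cdots\leq q_r$, $\mathfrak{p}\preceq_\imath\mathfrak{q}$ iff for all $t,s\in[r]$: $p_t\geq q_s$ whenever $s\leq\imath(t)-t$, and $p_t\leq q_s$ whenever $s>\imath(t)-t$. A partial order is a reflexive, antisymmetric, transitive relation. -}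

module Defs where

open import Level using (Level; _⊔_)
open import Data.Nat using (ℕ; zero; suc; _∸_; _*_; _%_) renaming (_≤_ to _≤ℕ_; _<_ to _<ℕ_)
open import Data.Fin using (Fin; toℕ) renaming (_≤_ to _≤F_; _<_ to _<F_)
open import Data.Vec using (Vec; lookup)
open import Data.Product using (Σ; _×_; proj₁)
open import Relation.Binary.Core using (Rel)
open import Relation.Binary.PropositionalEquality using (_≡_)

-- Conventions: [r] is represented by Fin r, where i : Fin r stands for the
-- natural number pos i = toℕ i + 1 ∈ {1,…,r}.  Similarly an element
-- j : Fin (r + r) of [2r] stands for toℕ j + 1.

pos : {r : ℕ} → Fin r → ℕ
pos i = suc (toℕ i)

val : {r : ℕ} → (Fin r → Fin (r Data.Nat.+ r)) → Fin r → ℕ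
val ı t = suc (toℕ (ı t))

StrictlyIncreasing : {r : ℕ} → (Fin r → Fin (r Data.Nat.+ r)) → Set
StrictlyIncreasing ı = ∀ i j → i <F j → ı i <F ı j

Multichain : {ℓ : Level} (n : ℕ) (_≤P_ : Rel (Fin n) ℓ) (r : ℕ) → Set ℓ
Multichain n _≤P_ r =
  Σ (Vec (Fin n) r) (λ v → ∀ (i j : Fin r) → i ≤F j → lookup v i ≤P lookup v j)

_≈M_ : {ℓ : Level} {n : ℕ} {_≤P_ : Rel (Fin n) ℓ} {r : ℕ} →
       Rel (Multichain n _≤P_ r) Level.zero
𝔭 ≈M 𝔮 = proj₁ 𝔭 ≡ proj₁ 𝔮

⪯[_] : {ℓ : Level} {n : ℕ} {_≤P_ : Rel (Fin n) ℓ} {r : ℕ} →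
       (Fin r → Fin (r Data.Nat.+ r)) → Rel (Multichain n _≤P_ r) ℓ
⪯[_] {_≤P_ = _≤P_} {r = r} ı 𝔭 𝔮 =
  ∀ (t s : Fin r) →
    (pos s ≤ℕ val ı t ∸ pos t → lookup (proj₁ 𝔮) s ≤P lookup (proj₁ 𝔭) t) ×
    (val ı t ∸ pos t <ℕ pos s → lookup (proj₁ 𝔭) t ≤P lookup (proj₁ 𝔮) s)

ParityCondition : {r : ℕ} → (Fin r → Fin (r Data.Nat.+ r)) → Set
ParityCondition ı = ∀ t → 2 ≤ℕ pos t →
  (pos t % 2 ≡ 0 → val ı t ≡ 2 * pos t) ×
  (pos t % 2 ≡ 1 → val ı t ≡ 2 * pos t ∸ 1)

-- The relation ⪯ı depends on ı only through the offsets κ t = ı(t) − t.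
-- If κ t is the least even number ≥ t (which, given ı(1) = 1, is the parity condition),
-- every comparison between p_t and q_s factors through a comparison of p_u with q_u
-- for a single index u, so ⪯ı is the coordinatewise order in which coordinate u is
-- compared downwards when u < κ u and upwards otherwise: a partial order.
-- Conversely, fix a < b in P and let θ x be the multichain that is a at the first x
-- positions and b afterwards.  Reflexivity at suitable θ x forces t ≤ κ t ≤ t + 1,
-- and transitivity along θ(m+2) ⪯ θ(m+1) ⪯ θ m, respectively θ m ⪯ θ(m+1) ⪯ θ(m+2),
-- determines κ(m+1) from κ m, so κ is the even ceiling by induction.
module Submission where

open import Defs
open import Level using (Level)
open import Data.Nat using (ℕ) renaming (_≤_ to _≤ℕ_)
open import Data.Fin using (Fin)
open import Data.Product using (Σ; _×_)
open import Relation.Binary.Core using (Rel)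
open import Relation.Binary.Structures using (IsPartialOrder)
open import Relation.Binary.PropositionalEquality using (_≡_)
open import Relation.Nullary using (¬_)
open import Function.Bundles using (_⇔_)

open import Data.Nat using (zero; suc; _+_; _*_; _∸_; _%_; _≤_; _<_; _≤?_; _<?_; _≟_; s≤s; z≤n)
open import Data.Nat.Properties
open import Data.Fin using (toℕ; fromℕ<)
open import Data.Fin.Properties using (toℕ-fromℕ<; toℕ<n; toℕ-injective)
open import Data.Vec using (lookup; tabulate)
open import Data.Vec.Properties using (lookup∘tabulate; tabulate∘lookup; tabulate-cong)
open import Data.Product using (_,_; proj₁; proj₂)
open import Data.Sum using (_⊎_; inj₁; inj₂; [_,_])
open import Function.Bundles using (mk⇔; Equivalence)
open import Relation.Binary.Definitions using (Reflexive; Transitive)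
open import Relation.Binary.PropositionalEquality using (_≢_; refl; sym; trans; cong; cong₂; subst; subst₂)
open import Relation.Nullary using (Dec; yes; no; contradiction)

open Equivalence using (to; from)

evenCeil : ℕ → ℕ
evenCeil zero = zero
evenCeil (suc zero) = 2
evenCeil (suc (suc m)) = suc (suc (evenCeil m))

evenCeil-cases : ∀ m → (evenCeil m ≡ m × suc m % 2 ≡ 1) ⊎ (evenCeil m ≡ suc m × suc m % 2 ≡ 0)
evenCeil-cases zero = inj₁ (refl , refl)
evenCeil-cases (suc zero) = inj₂ (refl , refl)
evenCeil-cases (suc (suc m)) with evenCeil-cases m
... | inj₁ (even , parity) = inj₁ (cong (λ k → suc (suc k)) even , parity)
... | inj₂ (odd , parity) = inj₂ (cong (λ k → suc (suc k)) odd , parity)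

evenCeil-suc-even : ∀ {m} → evenCeil m ≡ m → evenCeil (suc m) ≡ suc (suc m)
evenCeil-suc-even {zero} _ = refl
evenCeil-suc-even {suc zero} ()
evenCeil-suc-even {suc (suc m)} e =
  cong (λ k → suc (suc k)) (evenCeil-suc-even (suc-injective (suc-injective e)))

evenCeil-suc-fixed : ∀ {m} → evenCeil (suc m) ≡ suc m ⇔ evenCeil m ≡ suc m
evenCeil-suc-fixed {zero} = mk⇔ (λ ()) (λ ())
evenCeil-suc-fixed {suc zero} = mk⇔ (λ _ → refl) (λ _ → refl)
evenCeil-suc-fixed {suc (suc m)} =
  mk⇔ (λ e → cong (λ k → suc (suc k)) (to evenCeil-suc-fixed (suc-injective (suc-injective e))))
      (λ e → cong (λ k → suc (suc k)) (from evenCeil-suc-fixed (suc-injective (suc-injective e))))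

evenCeil-≤-suc : ∀ m → evenCeil m ≤ evenCeil (suc m)
evenCeil-≤-suc m with evenCeil-cases m
... | inj₁ (even , _) = subst₂ _≤_ (sym even) (sym (evenCeil-suc-even even)) (m≤n⇒m≤1+n (n≤1+n m))
... | inj₂ (odd , _) = ≤-reflexive (trans odd (sym (from evenCeil-suc-fixed odd)))

evenCeil-mono : ∀ {m n} → m ≤ n → evenCeil m ≤ evenCeil n
evenCeil-mono {n = zero} z≤n = ≤-refl
evenCeil-mono {n = suc n} m≤1+n with m≤n⇒m<n∨m≡n m≤1+n
... | inj₁ m<1+n = ≤-trans (evenCeil-mono (≤-pred m<1+n)) (evenCeil-≤-suc n)
... | inj₂ refl = ≤-refl

ParityAt : ℕ → ℕ → Set
ParityAt p v = (p % 2 ≡ 0 → v ≡ 2 * p) × (p % 2 ≡ 1 → v ≡ 2 * p ∸ 1)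

2*[1+m]≡1+[m+[1+m]] : ∀ m → 2 * suc m ≡ suc (m + suc m)
2*[1+m]≡1+[m+[1+m]] m = cong (λ k → suc (m + k)) (+-identityʳ (suc m))

2*[1+m]∸1≡1+[m+m] : ∀ m → 2 * suc m ∸ 1 ≡ suc (m + m)
2*[1+m]∸1≡1+[m+m] m = trans (cong (_∸ 1) (2*[1+m]≡1+[m+[1+m]] m)) (+-suc m m)

parityAt⇔ : ∀ m v → ParityAt (suc m) (suc v) ⇔ v ≡ m + evenCeil m
parityAt⇔ m v with evenCeil-cases m
... | inj₁ (even , 1+m-odd) = mk⇔
      (λ (_ , h) → trans (suc-injective (trans (h 1+m-odd) (2*[1+m]∸1≡1+[m+m] m))) (cong (m +_) (sym even)))
      (λ e → (λ 1+m-even → contradiction (trans (sym 1+m-odd) 1+m-even) λ ()) ,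
             (λ _ → trans (cong suc (trans e (cong (m +_) even))) (sym (2*[1+m]∸1≡1+[m+m] m))))
... | inj₂ (odd , 1+m-even) = mk⇔
      (λ (h , _) → trans (suc-injective (trans (h 1+m-even) (2*[1+m]≡1+[m+[1+m]] m))) (cong (m +_) (sym odd)))
      (λ e → (λ _ → trans (cong suc (trans e (cong (m +_) odd))) (sym (2*[1+m]≡1+[m+[1+m]] m))) ,
             (λ 1+m-odd → contradiction (trans (sym 1+m-even) 1+m-odd) λ ()))

evenCeil-positive : ∀ {m} → 0 < m → 0 < evenCeil m
evenCeil-positive {suc zero} _ = s≤s z≤n
evenCeil-positive {suc (suc m)} _ = s≤s z≤n

∸≡⇒≡+ : ∀ {a b k} → 0 < k → a ∸ b ≡ k → a ≡ b + k
∸≡⇒≡+ {a} {b} {suc k} _ a∸b≡k = trans (sym (m+[n∸m]≡n b≤a)) (cong (b +_) a∸b≡k)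
  where
  b≤a : b ≤ a
  b≤a = <⇒≤ (m∸n≢0⇒n<m λ a∸b≡0 → contradiction (trans (sym a∸b≡k) a∸b≡0) λ ())

module _ {ℓ : Level} {n : ℕ} {_≤P_ : Rel (Fin n) ℓ} {r : ℕ} where

  Chain : Set ℓ
  Chain = Multichain n _≤P_ r

  infixl 30 _!_
  _!_ : Chain → Fin r → Fin n
  p ! t = lookup (proj₁ p) t

  index : ∀ {k} → k < r → Σ (Fin r) (λ u → toℕ u ≡ k)
  index k<r = fromℕ< k<r , toℕ-fromℕ< k<r

  chain : (p : Chain) {i j : Fin r} → toℕ i ≤ toℕ j → p ! i ≤P p ! j
  chain p = proj₂ p _ _

  -- ⪯[ ı ] is definitionally _⪯⟨ offset ı ⟩_
  _⪯⟨_⟩_ : Chain → (Fin r → ℕ) → Chain → Set ℓ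
  p ⪯⟨ κ ⟩ q = ∀ t s → (pos s ≤ κ t → q ! s ≤P p ! t) × (κ t < pos s → p ! t ≤P q ! s)

  Diagonal : (Fin r → ℕ) → Rel Chain ℓ
  Diagonal κ p q = ∀ t → (pos t ≤ κ t → q ! t ≤P p ! t) × (κ t < pos t → p ! t ≤P q ! t)

  ≈M-from-! : {p q : Chain} → (∀ t → p ! t ≡ q ! t) → _≈M_ {_≤P_ = _≤P_} p q
  ≈M-from-! {p , _} {q , _} p≗q =
    trans (sym (tabulate∘lookup p)) (trans (tabulate-cong p≗q) (tabulate∘lookup q))

  module _ (isPO : IsPartialOrder _≡_ _≤P_) {κ : Fin r → ℕ} where
    private module P = IsPartialOrder isPO

    isPartialOrder-fromDiagonal : (∀ p q → Diagonal κ p q → p ⪯⟨ κ ⟩ q) →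
                                  IsPartialOrder (_≈M_ {_≤P_ = _≤P_}) (_⪯⟨ κ ⟩_)
    isPartialOrder-fromDiagonal fromDiagonal = record
      { isPreorder = record
        { isEquivalence = record { refl = refl ; sym = sym ; trans = trans }
        ; reflexive = λ { {p@(_ , _)} {_ , _} refl → fromDiagonal p p λ _ → (λ _ → P.refl) , (λ _ → P.refl) }
        ; trans = λ {p} {_} {r} pq qr → fromDiagonal p r λ t →
            (λ c → P.trans (proj₁ (qr t t) c) (proj₁ (pq t t) c)) ,
            (λ c → P.trans (proj₂ (pq t t) c) (proj₂ (qr t t) c))
        }
      ; antisym = λ {p} {q} pq qp → ≈M-from-! {p} {q} λ t → antisym-at {p} {q} pq qp t (pos t ≤? κ t)
      }
      where
      antisym-at : ∀ {p q} → p ⪯⟨ κ ⟩ q → q ⪯⟨ κ ⟩ p → ∀ t → Dec (pos t ≤ κ t) → p ! t ≡ q ! t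
      antisym-at pq qp t (yes c) = P.antisym (proj₁ (qp t t) c) (proj₁ (pq t t) c)
      antisym-at pq qp t (no c) = P.antisym (proj₂ (pq t t) (≰⇒> c)) (proj₂ (qp t t) (≰⇒> c))

    module _ {p q : Chain} (d : Diagonal κ p q) where
      ≤-through : ∀ {s t} u → toℕ s ≤ toℕ u → toℕ u ≤ toℕ t → pos u ≤ κ u → q ! s ≤P p ! t
      ≤-through u s≤u u≤t c = P.trans (chain q s≤u) (P.trans (proj₁ (d u) c) (chain p u≤t))

      ≥-through : ∀ {s t} u → toℕ t ≤ toℕ u → toℕ u ≤ toℕ s → κ u < pos u → p ! t ≤P q ! s
      ≥-through u t≤u u≤s c = P.trans (chain p t≤u) (P.trans (proj₂ (d u) c) (chain q u≤s))

    module _ (κ≡ : ∀ t → κ t ≡ evenCeil (toℕ t)) {p q : Chain} (d : Diagonal κ p q) where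
      κ-at : ∀ {u k} → toℕ u ≡ k → κ u ≡ evenCeil k
      κ-at {u} u≡k = trans (κ≡ u) (cong evenCeil u≡k)

      -- an even index t ≥ 2 is compared through the odd index t − 1
      ≤-at-even : ∀ {s t m} → toℕ t ≡ m → evenCeil m ≡ m → pos s ≤ m → q ! s ≤P p ! t
      ≤-at-even {s} {t} {suc k} t≡m even (s≤s s≤k) with index (<-trans (n<1+n k) (subst (_< r) t≡m (toℕ<n t)))
      ... | u , u≡k = ≤-through {p} {q} d u (subst (toℕ s ≤_) (sym u≡k) s≤k)
                        (subst₂ _≤_ (sym u≡k) (sym t≡m) (n≤1+n k))
                        (≤-reflexive (trans (cong suc u≡k) (sym (trans (κ-at u≡k) (to (evenCeil-suc-fixed {k}) even)))))

      ≥-at-even : ∀ {s t m} → toℕ t ≡ m → evenCeil m ≡ m → m < pos s → p ! t ≤P q ! s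
      ≥-at-even {t = t} t≡m even (s≤s m≤s) =
        ≥-through {p} {q} d t ≤-refl (subst (_≤ _) (sym t≡m) m≤s)
          (subst (_< pos t) (sym (trans (κ-at t≡m) even)) (s≤s (≤-reflexive (sym t≡m))))

      ≤-at-odd : ∀ {s t m} → toℕ t ≡ m → evenCeil m ≡ suc m → pos s ≤ suc m → q ! s ≤P p ! t
      ≤-at-odd {t = t} t≡m odd (s≤s s≤m) =
        ≤-through {p} {q} d t (subst (_ ≤_) (sym t≡m) s≤m) ≤-refl
          (subst (pos t ≤_) (sym (trans (κ-at t≡m) odd)) (s≤s (≤-reflexive t≡m)))

      -- an odd index t is compared through the even index t + 1
      ≥-at-odd : ∀ {s t m} → toℕ t ≡ m → evenCeil m ≡ suc m → suc m < pos s → p ! t ≤P q ! s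
      ≥-at-odd {s} {t} {m} t≡m odd (s≤s 1+m≤s) with index (≤-<-trans 1+m≤s (toℕ<n s))
      ... | u , u≡1+m = ≥-through {p} {q} d u (subst₂ _≤_ (sym t≡m) (sym u≡1+m) (n≤1+n m))
                          (subst (_≤ toℕ s) (sym u≡1+m) 1+m≤s)
                          (≤-reflexive (cong suc (trans (κ-at u≡1+m) (trans (from (evenCeil-suc-fixed {m}) odd) (sym u≡1+m)))))

    evenCeil-fromDiagonal : (∀ t → κ t ≡ evenCeil (toℕ t)) → ∀ p q → Diagonal κ p q → p ⪯⟨ κ ⟩ q
    evenCeil-fromDiagonal κ≡ p q d t s with evenCeil-cases (toℕ t)
    ... | inj₁ (even , _) =
          (λ c → ≤-at-even κ≡ {p} {q} d refl even (subst (pos s ≤_) κt c)) ,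
          (λ c → ≥-at-even κ≡ {p} {q} d refl even (subst (_< pos s) κt c))
      where κt = trans (κ≡ t) even
    ... | inj₂ (odd , _) =
          (λ c → ≤-at-odd κ≡ {p} {q} d refl odd (subst (pos s ≤_) κt c)) ,
          (λ c → ≥-at-odd κ≡ {p} {q} d refl odd (subst (_< pos s) κt c))
      where κt = trans (κ≡ t) odd

    evenCeil-isPartialOrder : (∀ t → κ t ≡ evenCeil (toℕ t)) → IsPartialOrder (_≈M_ {_≤P_ = _≤P_}) (_⪯⟨ κ ⟩_)
    evenCeil-isPartialOrder κ≡ = isPartialOrder-fromDiagonal (evenCeil-fromDiagonal κ≡)

  module Threshold (isPO : IsPartialOrder _≡_ _≤P_) {a b : Fin n} (a≤b : a ≤P b) (a≢b : a ≢ b) where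
    private module P = IsPartialOrder isPO

    pick : {A : Set} → Dec A → Fin n
    pick (yes _) = a
    pick (no _) = b

    pick-≤ : {A B : Set} (A? : Dec A) (B? : Dec B) → ¬ (¬ A × B) → pick A? ≤P pick B?
    pick-≤ (yes _) (yes _) _ = P.refl
    pick-≤ (yes _) (no _) _ = a≤b
    pick-≤ (no ¬A) (yes B) h = contradiction (¬A , B) h
    pick-≤ (no _) (no _) _ = P.refl

    pick-≰ : {A B : Set} (A? : Dec A) (B? : Dec B) → ¬ A → B → ¬ pick A? ≤P pick B?
    pick-≰ (yes A) _ ¬A _ _ = ¬A A
    pick-≰ (no _) (yes _) _ _ b≤a = a≢b (P.antisym a≤b b≤a)
    pick-≰ (no _) (no ¬B) _ B _ = ¬B B

    level : ℕ → Fin r → Fin n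
    level x i = pick (toℕ i <? x)

    level-≤ : ∀ {x y} i j → ¬ (x ≤ toℕ i × toℕ j < y) → level x i ≤P level y j
    level-≤ {x} {y} i j h = pick-≤ (toℕ i <? x) (toℕ j <? y) λ (i≮x , j<y) → h (≮⇒≥ i≮x , j<y)

    θ : ℕ → Chain
    θ x = tabulate (level x) , λ i j i≤j →
      subst₂ _≤P_ (sym (lookup∘tabulate (level x) i)) (sym (lookup∘tabulate (level x) j))
        (level-≤ i j λ (x≤i , j<x) → <⇒≱ j<x (≤-trans x≤i i≤j))

    θ-≤ : ∀ {x y} i j → ¬ (x ≤ toℕ i × toℕ j < y) → θ x ! i ≤P θ y ! j
    θ-≤ {x} {y} i j h =
      subst₂ _≤P_ (sym (lookup∘tabulate (level x) i)) (sym (lookup∘tabulate (level y) j)) (level-≤ i j h)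

    θ-≰ : ∀ {x y} i j → x ≤ toℕ i → toℕ j < y → ¬ θ x ! i ≤P θ y ! j
    θ-≰ {x} {y} i j x≤i j<y θxi≤θyj =
      pick-≰ (toℕ i <? x) (toℕ j <? y) (≤⇒≯ x≤i) j<y
        (subst₂ _≤P_ (lookup∘tabulate (level x) i) (lookup∘tabulate (level y) j) θxi≤θyj)

    module _ {κ : Fin r → ℕ} where
      θ-⪯ : ∀ {x y} → (∀ u → toℕ u < x → κ u ≤ y) → (∀ u → x ≤ toℕ u → y ≤ κ u) → θ x ⪯⟨ κ ⟩ θ y
      θ-⪯ below above t s =
        (λ s<κt → θ-≤ s t λ (y≤s , t<x) → <⇒≱ s<κt (≤-trans (below t t<x) y≤s)) ,
        (λ κt<s → θ-≤ t s λ (x≤t , s<y) → <⇒≱ s<y (≤-trans (above t x≤t) (≤-pred κt<s)))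

      θ-⋠ˡ : ∀ {x y} t s → toℕ t < x → y ≤ toℕ s → pos s ≤ κ t → ¬ θ x ⪯⟨ κ ⟩ θ y
      θ-⋠ˡ t s t<x y≤s s<κt θx⪯θy = θ-≰ s t y≤s t<x (proj₁ (θx⪯θy t s) s<κt)

      θ-⋠ʳ : ∀ {x y} t s → x ≤ toℕ t → toℕ s < y → κ t < pos s → ¬ θ x ⪯⟨ κ ⟩ θ y
      θ-⋠ʳ t s x≤t s<y κt<s θx⪯θy = θ-≰ t s x≤t s<y (proj₂ (θx⪯θy t s) κt<s)

      AgreesUpTo : ℕ → Set
      AgreesUpTo m = ∀ u → toℕ u ≤ m → κ u ≡ evenCeil (toℕ u)

      module _ (⪯-refl : Reflexive (_⪯⟨ κ ⟩_)) where
        toℕ≤κ : ∀ t → toℕ t ≤ κ t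
        toℕ≤κ t = ≮⇒≥ λ κt<t →
          let (s , s≡κt) = index (<-trans κt<t (toℕ<n t)) in
          θ-⋠ʳ t s ≤-refl (subst (_< toℕ t) (sym s≡κt) κt<t) (s≤s (≤-reflexive (sym s≡κt))) (⪯-refl {θ (toℕ t)})

        κ≤suc : (∀ t → κ t + toℕ t < r + r) → ∀ t → κ t ≤ suc (toℕ t)
        κ≤suc bound t = ≮⇒≥ λ 1+t<κt →
          let (s , s≡1+t) = index (room 1+t<κt) in
          θ-⋠ˡ t s ≤-refl (≤-reflexive (sym s≡1+t)) (subst (λ k → suc k ≤ κ t) (sym s≡1+t) 1+t<κt) (⪯-refl {θ (suc (toℕ t))})
          where
          room : suc (suc (toℕ t)) ≤ κ t → suc (toℕ t) < r
          room 2+t≤κt = ≰⇒> λ r≤1+t → <-irrefl refl (begin-strict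
            r + r                     ≤⟨ +-mono-≤ r≤1+t r≤1+t ⟩
            suc (toℕ t) + suc (toℕ t) ≡⟨ cong suc (+-suc (toℕ t) (toℕ t)) ⟩
            suc (suc (toℕ t)) + toℕ t ≤⟨ +-monoˡ-≤ (toℕ t) 2+t≤κt ⟩
            κ t + toℕ t               <⟨ bound t ⟩
            r + r                     ∎)
            where open ≤-Reasoning

        module _ (⪯-trans : Transitive (_⪯⟨ κ ⟩_)) (bound : ∀ t → κ t + toℕ t < r + r) where
          module Step {m : ℕ} (agrees : AgreesUpTo m) {t : Fin r} (t≡1+m : toℕ t ≡ suc m) where
            κ-below : ∀ u → toℕ u ≤ m → κ u ≤ evenCeil m
            κ-below u u≤m = subst (_≤ evenCeil m) (sym (agrees u u≤m)) (evenCeil-mono u≤m)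

            at-1+m : ∀ {u} → toℕ u ≡ suc m → t ≡ u
            at-1+m u≡1+m = toℕ-injective (trans t≡1+m (sym u≡1+m))

            m<r : m < r
            m<r = <-trans (n<1+n m) (subst (_< r) t≡1+m (toℕ<n t))

            1+m≤κt : suc m ≤ κ t
            1+m≤κt = subst (_≤ κ t) t≡1+m (toℕ≤κ t)

            -- θ(m+2) ⪯ θ(m+1) ⪯ θ m, but θ(m+2) ⋠ θ m unless κ t ≥ m + 2
            κ-step-even : evenCeil m ≡ m → κ t ≡ suc (suc m)
            κ-step-even even =
              ≤-antisym (subst (λ k → κ t ≤ suc k) t≡1+m (κ≤suc bound t)) (≮⇒≥ λ κt<2+m →
                let (s , s≡m) = index m<r
                    κt≤1+m = ≤-pred κt<2+m
                    θ₂⪯θ₁ = θ-⪯ {x = suc (suc m)} {y = suc m}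
                      (λ u u<2+m → [ (λ u<1+m → ≤-trans (κ-below u (≤-pred u<1+m)) (≤-trans (≤-reflexive even) (n≤1+n m)))
                                   , (λ u≡1+m → subst (λ v → κ v ≤ suc m) (at-1+m u≡1+m) κt≤1+m)
                                   ] (m≤n⇒m<n∨m≡n (≤-pred u<2+m)))
                      (λ u 2+m≤u → ≤-trans (n≤1+n (suc m)) (≤-trans 2+m≤u (toℕ≤κ u)))
                    θ₁⪯θ₀ = θ-⪯ {x = suc m} {y = m}
                      (λ u u<1+m → subst (κ u ≤_) even (κ-below u (≤-pred u<1+m)))
                      (λ u 1+m≤u → ≤-trans (n≤1+n m) (≤-trans 1+m≤u (toℕ≤κ u)))
                in θ-⋠ˡ t s (subst (_< suc (suc m)) (sym t≡1+m) ≤-refl) (≤-reflexive (sym s≡m))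
                     (subst (λ k → suc k ≤ κ t) (sym s≡m) 1+m≤κt)
                     (⪯-trans {θ (suc (suc m))} {θ (suc m)} {θ m} θ₂⪯θ₁ θ₁⪯θ₀))

            -- θ m ⪯ θ(m+1) ⪯ θ(m+2), but θ m ⋠ θ(m+2) unless κ t ≤ m + 1
            κ-step-odd : evenCeil m ≡ suc m → κ t ≡ suc m
            κ-step-odd odd =
              ≤-antisym (≮⇒≥ λ 1+m<κt →
                let (u , u≡m) = index m<r
                    κu≡1+m = trans (agrees u (≤-reflexive u≡m)) (trans (cong evenCeil u≡m) odd)
                    θ₀⪯θ₁ = θ-⪯ {x = m} {y = suc m}
                      (λ v v<m → subst (κ v ≤_) odd (κ-below v (<⇒≤ v<m)))
                      (λ v m≤v → [ (λ m<v → ≤-trans m<v (toℕ≤κ v))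
                                 , (λ m≡v → ≤-reflexive (sym (trans (agrees v (≤-reflexive (sym m≡v)))
                                                                  (trans (cong evenCeil (sym m≡v)) odd))))
                                 ] (m≤n⇒m<n∨m≡n m≤v))
                    θ₁⪯θ₂ = θ-⪯ {x = suc m} {y = suc (suc m)}
                      (λ v v<1+m → ≤-trans (subst (κ v ≤_) odd (κ-below v (≤-pred v<1+m))) (n≤1+n (suc m)))
                      (λ v 1+m≤v → [ (λ 1+m<v → ≤-trans 1+m<v (toℕ≤κ v))
                                   , (λ 1+m≡v → subst (λ w → suc (suc m) ≤ κ w) (at-1+m (sym 1+m≡v)) 1+m<κt)
                                   ] (m≤n⇒m<n∨m≡n 1+m≤v))
                in θ-⋠ʳ u t (≤-reflexive (sym u≡m)) (subst (_< suc (suc m)) (sym t≡1+m) ≤-refl)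
                     (subst₂ _<_ (sym κu≡1+m) (cong suc (sym t≡1+m)) ≤-refl)
                     (⪯-trans {θ m} {θ (suc m)} {θ (suc (suc m))} θ₀⪯θ₁ θ₁⪯θ₂))
              1+m≤κt

            κ-step : κ t ≡ evenCeil (suc m)
            κ-step with evenCeil-cases m
            ... | inj₁ (even , _) = trans (κ-step-even even) (sym (evenCeil-suc-even even))
            ... | inj₂ (odd , _) = trans (κ-step-odd odd) (sym (from evenCeil-suc-fixed odd))

          κ≡evenCeil : (∀ t → toℕ t ≡ 0 → κ t ≡ 0) → ∀ t → κ t ≡ evenCeil (toℕ t)
          κ≡evenCeil κ-zero t = agreesUpTo (toℕ t) t ≤-refl
            where
            agreesUpTo : ∀ m → AgreesUpTo m
            agreesUpTo zero u u≤0 = trans (κ-zero u (n≤0⇒n≡0 u≤0)) (sym (cong evenCeil (n≤0⇒n≡0 u≤0)))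
            agreesUpTo (suc m) u u≤1+m =
              [ (λ u<1+m → agreesUpTo m u (≤-pred u<1+m))
              , (λ u≡1+m → trans (Step.κ-step (agreesUpTo m) u≡1+m) (cong evenCeil (sym u≡1+m)))
              ] (m≤n⇒m<n∨m≡n u≤1+m)

module _ {r : ℕ} (ı : Fin r → Fin (r + r)) where

  offset : Fin r → ℕ
  offset t = toℕ (ı t) ∸ toℕ t

  offset-bound : ∀ t → offset t + toℕ t < r + r
  offset-bound t with toℕ t ≤? toℕ (ı t)
  ... | yes t≤ıt = subst (_< r + r) (sym (m∸n+n≡m t≤ıt)) (toℕ<n (ı t))
  ... | no t≰ıt = subst (_< r + r) (cong (_+ toℕ t) (sym (m≤n⇒m∸n≡0 (<⇒≤ (≰⇒> t≰ıt)))))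
                    (<-≤-trans (toℕ<n t) (m≤m+n r r))

  module _ (base : ∀ t → pos t ≡ 1 → val ı t ≡ 1) where
    offset-zero : ∀ t → toℕ t ≡ 0 → offset t ≡ 0
    offset-zero t t≡0 = cong₂ _∸_ (suc-injective (base t (cong suc t≡0))) t≡0

    parityCondition⇔ : ParityCondition ı ⇔ (∀ t → offset t ≡ evenCeil (toℕ t))
    parityCondition⇔ = mk⇔ offset≡evenCeil parity
      where
      offset≡evenCeil : ParityCondition ı → ∀ t → offset t ≡ evenCeil (toℕ t)
      offset≡evenCeil par t with toℕ t ≟ 0
      ... | yes t≡0 = trans (offset-zero t t≡0) (cong evenCeil (sym t≡0))
      ... | no t≢0 = trans (cong (_∸ toℕ t) (to (parityAt⇔ (toℕ t) (toℕ (ı t))) (par t (s≤s (n≢0⇒n>0 t≢0)))))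
                           (m+n∸m≡n (toℕ t) (evenCeil (toℕ t)))

      parity : (∀ t → offset t ≡ evenCeil (toℕ t)) → ParityCondition ı
      parity off t 2≤pos =
        from (parityAt⇔ (toℕ t) (toℕ (ı t))) (∸≡⇒≡+ (evenCeil-positive (≤-pred 2≤pos)) (off t))

proposition1p2 : {ℓ : Level} (n : ℕ) (_≤P_ : Rel (Fin n) ℓ) →
    IsPartialOrder _≡_ _≤P_ →
    Σ (Fin n) (λ p → Σ (Fin n) (λ q → p ≤P q × ¬ (p ≡ q))) →
    (r : ℕ) → 1 ≤ℕ r →
    (ı : Fin r → Fin (r Data.Nat.+ r)) → StrictlyIncreasing ı →
    (∀ t → pos t ≡ 1 → val ı t ≡ 1) →
    (IsPartialOrder (_≈M_ {_≤P_ = _≤P_}) (⪯[_] {_≤P_ = _≤P_} ı) ⇔ ParityCondition ı)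
proposition1p2 n _≤P_ isPO (a , b , a≤b , a≢b) r _ ı _ base = mk⇔
  (λ isPO⪯ → let module ⪯ = IsPartialOrder isPO⪯ in
    from (parityCondition⇔ ı base)
      (κ≡evenCeil (λ {p} → ⪯.refl {p}) (λ {p} {q} {w} → ⪯.trans {p} {q} {w}) (offset-bound ı) (offset-zero ı base)))
  (λ parity → evenCeil-isPartialOrder isPO (to (parityCondition⇔ ı base) parity))
  where open Threshold isPO a≤b a≢b
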